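{- Let $H$ be a multigraph whose edge set is an edge-disjoint union of cliques, each a complete graph on exactly $\Delta\ge2$ vertices (and with at least one edge). Let $I_\ell$ be the graph on $\ell$ vertices with no edges. For each integer $\ell\ge1$, every cut in the graph $H\times I_\ell$ contains at most a $\frac12+\frac{1}{2(\Delta-1)}\le\frac12+\frac1\Delta$ fraction of the edges.
   Context: $H\times I_\ell$ is the multigraph with vertex set $V(H)\times[\ell]$ in which each edge $(u,v)$ of $H$ (with multiplicity) gives rise to an edge between $(u,i)$ and $(v,j)$ for every $i,j\in[\ell]$ (so each edge of $H$ yields $\ell^2$ edges). A cut is a partition of the vertex set into two parts; it contains the edges with endpoints in different parts. -}

module Defs where

open import Data.Nat using (ℕ)
open import Data.Fin using (Fin; _<?_)
open import Data.Bool using (Bool; _≟_)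
open import Data.List using (List; map; concatMap; filter; length; allFin)
open import Data.Product using (Σ; _×_; _,_; proj₁; proj₂)
open import Function.Definitions using (Injective)
open import Relation.Binary.PropositionalEquality using (_≡_)
open import Relation.Nullary using (¬?)

Clique : ℕ → ℕ → Set
Clique n Δ = Σ (Fin Δ → Fin n) (Injective _≡_ _≡_)

orderedPairs : (Δ : ℕ) → List (Fin Δ × Fin Δ)
orderedPairs Δ =
  filter (λ p → proj₁ p <? proj₂ p)
         (concatMap (λ i → map (λ j → (i , j)) (allFin Δ)) (allFin Δ))

cliqueEdges : ∀ {n Δ} → Clique n Δ → List (Fin n × Fin n)
cliqueEdges {Δ = Δ} (K , _) = map (λ p → (K (proj₁ p) , K (proj₂ p))) (orderedPairs Δ)

-- The multigraph H whose edge multiset is the edge-disjoint union of the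
-- given cliques (each clique contributes its own copies of edges).
edgesH : ∀ {n Δ} → List (Clique n Δ) → List (Fin n × Fin n)
edgesH = concatMap cliqueEdges

productEdges : ∀ {n} (ℓ : ℕ) → List (Fin n × Fin n) →
               List ((Fin n × Fin ℓ) × (Fin n × Fin ℓ))
productEdges ℓ = concatMap (λ e →
  concatMap (λ i → map (λ j → ((proj₁ e , i) , (proj₂ e , j))) (allFin ℓ)) (allFin ℓ))

cutSize : ∀ {V : Set} → (V → Bool) → List (V × V) → ℕ
cutSize S es = length (filter (λ e → ¬? (S (proj₁ e) ≟ S (proj₂ e))) es)

module Submission where

-- Summing over the cliques, it suffices to bound the cut of one copy of K_Δ × I_ℓ, whose
-- vertices form Δ blocks of size ℓ. The cut between two blocks is symmetric in the blocks,
-- so twice the cut is at most the number of ordered pairs of differently coloured vertices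
-- among all Δℓ vertices, namely 2AB with A + B = Δℓ the colour class sizes. Hence
-- cut ≤ AB ≤ (Δℓ)²/4, while K_Δ × I_ℓ has Δ(Δ−1)ℓ²/2 edges. The second bound follows from
-- the first because Δ² ≤ (Δ−1)(Δ+2) once Δ ≥ 2.

open import Defs
open import Data.Nat using (ℕ; zero; suc; _*_; _+_; _∸_; _≤_; z≤n; s≤s)
open import Data.Nat.Properties
  using ( +-*-semiring; +-mono-≤; *-monoʳ-≤; *-monoˡ-≤; *-cancelˡ-≤; *-distribˡ-+; *-distribʳ-+
        ; *-identityʳ; +-identityʳ; +-comm; *-comm; *-identityˡ; *-zeroʳ; ≤-trans; ≤-reflexive; ≤-total; m≤m+n; m≤n⇒∃[o]m+o≡n
        ; module ≤-Reasoning )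
open import Data.Nat.ListAction using (sum)
open import Data.Nat.ListAction.Properties using (sum-++)
open import Data.Nat.Tactic.RingSolver using (solve-∀)
open import Algebra.Properties.Semiring.Sum +-*-semiring
  using (sum-syntax; ∑-comm; ∑-distrib-+; *-distribʳ-sum) renaming (sum-cong-≗ to ∑-cong)
open import Data.Fin using (Fin; zero; suc; _<?_)
open import Data.Fin.Properties using (<-asym)
open import Data.Bool using (Bool; true; false; not; _≟_)
open import Data.List using (List; []; _∷_; _++_; map; concatMap; filter; length; allFin; tabulate)
open import Data.List.Properties using (map-++; map-∘; map-cong)
open import Data.Product using (_×_; _,_; proj₁; proj₂)
open import Data.Sum using ([_,_]′)
open import Function using (_∘_)
open import Relation.Nullary using (Dec; yes; no; does; ¬_; ¬?; contradiction)
open import Relation.Binary.PropositionalEquality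
  using (_≡_; _≢_; refl; sym; trans; cong; cong₂; subst; subst₂; module ≡-Reasoning)

𝟙 : Bool → ℕ
𝟙 true  = 1
𝟙 false = 0

∑-const : ∀ n c → ∑[ i < n ] c ≡ n * c
∑-const zero    c = refl
∑-const (suc n) c = cong (c +_) (∑-const n c)

∑-mono-≤ : ∀ {n} {f g : Fin n → ℕ} → (∀ i → f i ≤ g i) → ∑[ i < n ] f i ≤ ∑[ i < n ] g i
∑-mono-≤ {zero}  f≤g = z≤n
∑-mono-≤ {suc n} f≤g = +-mono-≤ (f≤g zero) (∑-mono-≤ (f≤g ∘ suc))

module _ {A : Set} where

  length≡sum-ones : (xs : List A) → length xs ≡ sum (map (λ _ → 1) xs)
  length≡sum-ones []       = refl
  length≡sum-ones (x ∷ xs) = cong suc (length≡sum-ones xs)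

  sum-map-filter : ∀ {p} {P : A → Set p} (P? : ∀ x → Dec (P x)) (w : A → ℕ) xs →
    sum (map w (filter P? xs)) ≡ sum (map (λ x → 𝟙 (does (P? x)) * w x) xs)
  sum-map-filter P? w []       = refl
  sum-map-filter P? w (x ∷ xs) with does (P? x)
  ... | false = sum-map-filter P? w xs
  ... | true  = cong₂ _+_ (sym (+-identityʳ (w x))) (sum-map-filter P? w xs)

  length-filter≡sum : ∀ {p} {P : A → Set p} (P? : ∀ x → Dec (P x)) xs →
    length (filter P? xs) ≡ sum (map (λ x → 𝟙 (does (P? x))) xs)
  length-filter≡sum P? xs = begin
    length (filter P? xs)                             ≡⟨ length≡sum-ones (filter P? xs) ⟩
    sum (map (λ _ → 1) (filter P? xs))                ≡⟨ sum-map-filter P? (λ _ → 1) xs ⟩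
    sum (map (λ x → 𝟙 (does (P? x)) * 1) xs)          ≡⟨ cong sum (map-cong (λ x → *-identityʳ _) xs) ⟩
    sum (map (λ x → 𝟙 (does (P? x))) xs)              ∎
    where open ≡-Reasoning

  sum-map-tabulate : ∀ {n} (w : A → ℕ) (f : Fin n → A) → sum (map w (tabulate f)) ≡ ∑[ i < n ] w (f i)
  sum-map-tabulate {zero}  w f = refl
  sum-map-tabulate {suc n} w f = cong (w (f zero) +_) (sum-map-tabulate w (f ∘ suc))

  module _ {B : Set} where

    sum-map-map : ∀ (w : B → ℕ) (f : A → B) xs → sum (map w (map f xs)) ≡ sum (map (w ∘ f) xs)
    sum-map-map w f xs = cong sum (sym (map-∘ xs))

    sum-map-concatMap : ∀ (w : B → ℕ) (f : A → List B) xs →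
      sum (map w (concatMap f xs)) ≡ sum (map (λ x → sum (map w (f x))) xs)
    sum-map-concatMap w f []       = refl
    sum-map-concatMap w f (x ∷ xs) = begin
      sum (map w (f x ++ concatMap f xs))                   ≡⟨ cong sum (map-++ w (f x) _) ⟩
      sum (map w (f x) ++ map w (concatMap f xs))           ≡⟨ sum-++ (map w (f x)) _ ⟩
      sum (map w (f x)) + sum (map w (concatMap f xs))      ≡⟨ cong (sum (map w (f x)) +_) (sum-map-concatMap w f xs) ⟩
      sum (map w (f x)) + sum (map (λ y → sum (map w (f y))) xs) ∎
      where open ≡-Reasoning

  sum-map-mono-* : ∀ a b {f g : A → ℕ} → (∀ x → a * f x ≤ b * g x) → ∀ xs →
    a * sum (map f xs) ≤ b * sum (map g xs)
  sum-map-mono-* a b f≤g [] rewrite *-zeroʳ a = z≤n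
  sum-map-mono-* a b {f} {g} f≤g (x ∷ xs)
    rewrite *-distribˡ-+ a (f x) (sum (map f xs)) | *-distribˡ-+ b (g x) (sum (map g xs))
    = +-mono-≤ (f≤g x) (sum-map-mono-* a b f≤g xs)

sum-map-grid : ∀ {B : Set} m n (w : B → ℕ) (f : Fin m → Fin n → B) →
  sum (map w (concatMap (λ i → map (f i) (allFin n)) (allFin m))) ≡ ∑[ i < m ] ∑[ j < n ] w (f i j)
sum-map-grid m n w f = begin
  sum (map w (concatMap (λ i → map (f i) (allFin n)) (allFin m)))
    ≡⟨ sum-map-concatMap w (λ i → map (f i) (allFin n)) (allFin m) ⟩
  sum (map (λ i → sum (map w (map (f i) (allFin n)))) (allFin m))
    ≡⟨ sum-map-tabulate (λ i → sum (map w (map (f i) (allFin n)))) (λ i → i) ⟩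
  ∑[ i < m ] sum (map w (map (f i) (allFin n)))
    ≡⟨ ∑-cong (λ i → trans (sum-map-map w (f i) (allFin n)) (sum-map-tabulate (w ∘ f i) (λ j → j))) ⟩
  ∑[ i < m ] ∑[ j < n ] w (f i j) ∎
  where open ≡-Reasoning

[_<_] : ∀ {n} → Fin n → Fin n → ℕ
[ p < q ] = 𝟙 (does (p <? q))

pairSum : ∀ {n} → (Fin n → Fin n → ℕ) → ℕ
pairSum {n} X = ∑[ p < n ] ∑[ q < n ] ([ p < q ] * X p q)

[<]+[>]≤1 : ∀ {n} (p q : Fin n) → [ p < q ] + [ q < p ] ≤ 1
[<]+[>]≤1 p q = exclusive (p <? q) (q <? p) <-asym
  where
  exclusive : ∀ {A B : Set} (a? : Dec A) (b? : Dec B) → (A → ¬ B) → 𝟙 (does a?) + 𝟙 (does b?) ≤ 1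
  exclusive (yes a) (yes b) a⇒¬b = contradiction b (a⇒¬b a)
  exclusive (yes _) (no _)  _    = s≤s z≤n
  exclusive (no _)  (yes _) _    = s≤s z≤n
  exclusive (no _)  (no _)  _    = z≤n

∑[<]+[>]≡n∸1 : ∀ {n} (p : Fin n) → ∑[ q < n ] ([ p < q ] + [ q < p ]) ≡ n ∸ 1
∑[<]+[>]≡n∸1 {suc n}       zero    = trans (∑-const n 1) (*-identityʳ n)
∑[<]+[>]≡n∸1 {suc (suc n)} (suc p) = cong suc (∑[<]+[>]≡n∸1 p)

2*pairSum : ∀ {n} (X : Fin n → Fin n → ℕ) → (∀ p q → X p q ≡ X q p) →
  2 * pairSum X ≡ ∑[ p < n ] ∑[ q < n ] (([ p < q ] + [ q < p ]) * X p q)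
2*pairSum {n} X sym-X = sym (begin
  ∑[ p < n ] ∑[ q < n ] (([ p < q ] + [ q < p ]) * X p q)
    ≡⟨ ∑-cong (λ p → trans (∑-cong (λ q → *-distribʳ-+ (X p q) [ p < q ] [ q < p ]))
                                (∑-distrib-+ (λ q → [ p < q ] * X p q) (λ q → [ q < p ] * X p q))) ⟩
  ∑[ p < n ] (∑[ q < n ] ([ p < q ] * X p q) + ∑[ q < n ] ([ q < p ] * X p q))
    ≡⟨ ∑-distrib-+ (λ p → ∑[ q < n ] ([ p < q ] * X p q)) (λ p → ∑[ q < n ] ([ q < p ] * X p q)) ⟩
  pairSum X + ∑[ p < n ] ∑[ q < n ] ([ q < p ] * X p q)
    ≡⟨ cong (pairSum X +_) (∑-comm (λ p q → [ q < p ] * X p q)) ⟩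
  pairSum X + ∑[ q < n ] ∑[ p < n ] ([ q < p ] * X p q)
    ≡⟨ cong (pairSum X +_) (∑-cong (λ q → ∑-cong (λ p → cong ([ q < p ] *_) (sym-X p q)))) ⟩
  pairSum X + pairSum X
    ≡⟨ cong (pairSum X +_) (+-identityʳ (pairSum X)) ⟨
  2 * pairSum X ∎)
  where open ≡-Reasoning

2*pairSum≤∑∑ : ∀ {n} (X : Fin n → Fin n → ℕ) → (∀ p q → X p q ≡ X q p) →
  2 * pairSum X ≤ ∑[ p < n ] ∑[ q < n ] X p q
2*pairSum≤∑∑ {n} X sym-X = begin
  2 * pairSum X
    ≡⟨ 2*pairSum X sym-X ⟩
  ∑[ p < n ] ∑[ q < n ] (([ p < q ] + [ q < p ]) * X p q)
    ≤⟨ ∑-mono-≤ (λ p → ∑-mono-≤ (λ q → ≤-trans (*-monoˡ-≤ (X p q) ([<]+[>]≤1 p q)) (≤-reflexive (*-identityˡ (X p q))))) ⟩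
  ∑[ p < n ] ∑[ q < n ] X p q ∎
  where open ≤-Reasoning

2*pairSum-const : ∀ n c → 2 * pairSum {n} (λ _ _ → c) ≡ n * ((n ∸ 1) * c)
2*pairSum-const n c = begin
  2 * pairSum {n} (λ _ _ → c)
    ≡⟨ 2*pairSum {n} (λ _ _ → c) (λ _ _ → refl) ⟩
  ∑[ p < n ] ∑[ q < n ] (([ p < q ] + [ q < p ]) * c)
    ≡⟨ ∑-cong {n} (λ p → trans (sym (*-distribʳ-sum c (λ q → [ p < q ] + [ q < p ]))) (cong (_* c) (∑[<]+[>]≡n∸1 p))) ⟩
  ∑[ p < n ] ((n ∸ 1) * c)
    ≡⟨ ∑-const n ((n ∸ 1) * c) ⟩
  n * ((n ∸ 1) * c) ∎
  where open ≡-Reasoning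

4*m*n≤[m+n]² : ∀ m n → 4 * (m * n) ≤ (m + n) * (m + n)
4*m*n≤[m+n]² m n = [ ordered , swapped ]′ (≤-total m n)
  where
  ordered : ∀ {m n} → m ≤ n → 4 * (m * n) ≤ (m + n) * (m + n)
  ordered {m} m≤n with k , refl ← m≤n⇒∃[o]m+o≡n m≤n =
    subst (4 * (m * (m + k)) ≤_) (sym (square m k)) (m≤m+n _ (k * k))
    where
    square : ∀ m k → (m + (m + k)) * (m + (m + k)) ≡ 4 * (m * (m + k)) + k * k
    square = solve-∀

  swapped : n ≤ m → 4 * (m * n) ≤ (m + n) * (m + n)
  swapped n≤m = subst₂ _≤_ (cong (4 *_) (*-comm n m)) (cong₂ _*_ (+-comm n m) (+-comm n m)) (ordered n≤m)

disagree : Bool → Bool → ℕ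
disagree a b = 𝟙 (does (¬? (a ≟ b)))

disagree-sym : ∀ a b → disagree a b ≡ disagree b a
disagree-sym false false = refl
disagree-sym false true  = refl
disagree-sym true  false = refl
disagree-sym true  true  = refl

𝟙+𝟙-not : ∀ a → 𝟙 a + 𝟙 (not a) ≡ 1
𝟙+𝟙-not false = refl
𝟙+𝟙-not true  = refl

module _ {m ℓ : ℕ} where

  ∑² : (Fin m → Fin ℓ → ℕ) → ℕ
  ∑² f = ∑[ p < m ] ∑[ i < ℓ ] f p i

  ∑²-cong : ∀ {f g} → (∀ p i → f p i ≡ g p i) → ∑² f ≡ ∑² g
  ∑²-cong f≡g = ∑-cong (λ p → ∑-cong (f≡g p))

  ∑²-distrib-+ : ∀ f g → ∑² (λ p i → f p i + g p i) ≡ ∑² f + ∑² g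
  ∑²-distrib-+ f g = trans (∑-cong (λ p → ∑-distrib-+ (f p) (g p)))
                           (∑-distrib-+ (λ p → ∑[ i < ℓ ] f p i) (λ p → ∑[ i < ℓ ] g p i))

  *-distribʳ-∑² : ∀ x f → ∑² f * x ≡ ∑² (λ p i → f p i * x)
  *-distribʳ-∑² x f = trans (*-distribʳ-sum x (λ p → ∑[ i < ℓ ] f p i))
                            (∑-cong (λ p → *-distribʳ-sum x (f p)))

  ∑²-const : ∀ x → ∑² (λ _ _ → x) ≡ m * (ℓ * x)
  ∑²-const x = trans (∑-cong {m} (λ _ → ∑-const ℓ x)) (∑-const m (ℓ * x))

  module _ (c : Fin m → Fin ℓ → Bool) where

    blockCut : Fin m → Fin m → ℕ
    blockCut p q = ∑[ i < ℓ ] ∑[ j < ℓ ] disagree (c p i) (c q j)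

    blockCut-sym : ∀ p q → blockCut p q ≡ blockCut q p
    blockCut-sym p q = trans (∑-cong (λ i → ∑-cong (λ j → disagree-sym (c p i) (c q j))))
                             (∑-comm (λ i j → disagree (c q j) (c p i)))

    #true #false : ℕ
    #true  = ∑² (λ p i → 𝟙 (c p i))
    #false = ∑² (λ p i → 𝟙 (not (c p i)))

    #true+#false : #true + #false ≡ m * ℓ
    #true+#false = begin
      #true + #false                          ≡⟨ ∑²-distrib-+ (λ p i → 𝟙 (c p i)) (λ p i → 𝟙 (not (c p i))) ⟨
      ∑² (λ p i → 𝟙 (c p i) + 𝟙 (not (c p i))) ≡⟨ ∑²-cong (λ p i → 𝟙+𝟙-not (c p i)) ⟩
      ∑² (λ _ _ → 1)                          ≡⟨ ∑²-const 1 ⟩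
      m * (ℓ * 1)                             ≡⟨ cong (m *_) (*-identityʳ ℓ) ⟩
      m * ℓ                                   ∎
      where open ≡-Reasoning

    disagreements : Bool → ℕ
    disagreements a = ∑² (λ q j → disagree a (c q j))

    disagreements≡ : ∀ a → disagreements a ≡ 𝟙 a * #false + 𝟙 (not a) * #true
    disagreements≡ true  = trans (∑²-cong (λ q j → disagree-true (c q j)))
                                 (sym (trans (+-identityʳ _) (+-identityʳ #false)))
      where
      disagree-true : ∀ b → disagree true b ≡ 𝟙 (not b)
      disagree-true false = refl
      disagree-true true  = refl
    disagreements≡ false = trans (∑²-cong (λ q j → disagree-false (c q j))) (sym (+-identityʳ #true))
      where
      disagree-false : ∀ b → disagree false b ≡ 𝟙 b
      disagree-false false = refl
      disagree-false true  = refl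

    ∑∑blockCut≡ : ∑[ p < m ] ∑[ q < m ] blockCut p q ≡ #true * #false + #false * #true
    ∑∑blockCut≡ = begin
      ∑[ p < m ] ∑[ q < m ] blockCut p q
        ≡⟨ ∑-cong (λ p → ∑-comm (λ q i → ∑[ j < ℓ ] disagree (c p i) (c q j))) ⟩
      ∑² (λ p i → disagreements (c p i))
        ≡⟨ ∑²-cong (λ p i → disagreements≡ (c p i)) ⟩
      ∑² (λ p i → 𝟙 (c p i) * #false + 𝟙 (not (c p i)) * #true)
        ≡⟨ ∑²-distrib-+ (λ p i → 𝟙 (c p i) * #false) (λ p i → 𝟙 (not (c p i)) * #true) ⟩
      ∑² (λ p i → 𝟙 (c p i) * #false) + ∑² (λ p i → 𝟙 (not (c p i)) * #true)
        ≡⟨ cong₂ _+_ (*-distribʳ-∑² #false (λ p i → 𝟙 (c p i))) (*-distribʳ-∑² #true (λ p i → 𝟙 (not (c p i)))) ⟨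
      #true * #false + #false * #true ∎
      where open ≡-Reasoning

    ∑∑blockCut-≤ : 2 * ∑[ p < m ] ∑[ q < m ] blockCut p q ≤ (m * ℓ) * (m * ℓ)
    ∑∑blockCut-≤ = begin
      2 * ∑[ p < m ] ∑[ q < m ] blockCut p q ≡⟨ cong (2 *_) ∑∑blockCut≡ ⟩
      2 * (#true * #false + #false * #true)   ≡⟨ double-symmetric #true #false ⟩
      4 * (#true * #false)                    ≤⟨ 4*m*n≤[m+n]² #true #false ⟩
      (#true + #false) * (#true + #false)     ≡⟨ cong (λ x → x * x) #true+#false ⟩
      (m * ℓ) * (m * ℓ)                       ∎
      where
      open ≤-Reasoning
      double-symmetric : ∀ x y → 2 * (x * y + y * x) ≡ 4 * (x * y)
      double-symmetric = solve-∀

cliqueCut-bound : ∀ {Δ ℓ} (c : Fin Δ → Fin ℓ → Bool) →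
  2 * (Δ ∸ 1) * pairSum (blockCut c) ≤ Δ * pairSum {Δ} (λ _ _ → ℓ * ℓ)
cliqueCut-bound {Δ} {ℓ} c = *-cancelˡ-≤ 2 (begin
  2 * (2 * (Δ ∸ 1) * pairSum (blockCut c))       ≡⟨ regroup (Δ ∸ 1) (pairSum (blockCut c)) ⟩
  (Δ ∸ 1) * (2 * (2 * pairSum (blockCut c)))     ≤⟨ *-monoʳ-≤ (Δ ∸ 1) (*-monoʳ-≤ 2 (2*pairSum≤∑∑ (blockCut c) (blockCut-sym c))) ⟩
  (Δ ∸ 1) * (2 * ∑[ p < Δ ] ∑[ q < Δ ] blockCut c p q) ≤⟨ *-monoʳ-≤ (Δ ∸ 1) (∑∑blockCut-≤ c) ⟩
  (Δ ∸ 1) * ((Δ * ℓ) * (Δ * ℓ))                  ≡⟨ rearrange (Δ ∸ 1) Δ ℓ ⟩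
  Δ * (Δ * ((Δ ∸ 1) * (ℓ * ℓ)))                  ≡⟨ cong (Δ *_) (2*pairSum-const Δ (ℓ * ℓ)) ⟨
  Δ * (2 * pairSum {Δ} (λ _ _ → ℓ * ℓ))          ≡⟨ move-2 Δ (pairSum {Δ} (λ _ _ → ℓ * ℓ)) ⟩
  2 * (Δ * pairSum {Δ} (λ _ _ → ℓ * ℓ))          ∎)
  where
  open ≤-Reasoning
  regroup : ∀ k u → 2 * (2 * k * u) ≡ k * (2 * (2 * u))
  regroup = solve-∀
  rearrange : ∀ k Δ ℓ → k * ((Δ * ℓ) * (Δ * ℓ)) ≡ Δ * (Δ * (k * (ℓ * ℓ)))
  rearrange = solve-∀
  move-2 : ∀ a b → a * (2 * b) ≡ 2 * (a * b)
  move-2 = solve-∀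

module _ {n : ℕ} where

  sum-map-cliqueEdges : ∀ {Δ} (K : Clique n Δ) (v : Fin n × Fin n → ℕ) →
    sum (map v (cliqueEdges K)) ≡ pairSum (λ p q → v (proj₁ K p , proj₁ K q))
  sum-map-cliqueEdges {Δ} (K , _) v = begin
    sum (map v (map edge (orderedPairs Δ)))
      ≡⟨ sum-map-map v edge (orderedPairs Δ) ⟩
    sum (map (v ∘ edge) (orderedPairs Δ))
      ≡⟨ sum-map-filter (λ pq → proj₁ pq <? proj₂ pq) (v ∘ edge) (concatMap (λ p → map (p ,_) (allFin Δ)) (allFin Δ)) ⟩
    sum (map (λ pq → [ proj₁ pq < proj₂ pq ] * v (edge pq)) (concatMap (λ p → map (p ,_) (allFin Δ)) (allFin Δ)))
      ≡⟨ sum-map-grid Δ Δ (λ pq → [ proj₁ pq < proj₂ pq ] * v (edge pq)) _,_ ⟩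
    pairSum (λ p q → v (K p , K q)) ∎
    where
    open ≡-Reasoning
    edge : Fin Δ × Fin Δ → Fin n × Fin n
    edge (p , q) = (K p , K q)

  cliqueWeight : ∀ {Δ} ℓ → ((Fin n × Fin ℓ) × (Fin n × Fin ℓ) → ℕ) → Clique n Δ → ℕ
  cliqueWeight ℓ w (K , _) = pairSum (λ p q → ∑[ i < ℓ ] ∑[ j < ℓ ] w ((K p , i) , (K q , j)))

  sum-map-productEdges : ∀ {Δ} ℓ (w : (Fin n × Fin ℓ) × (Fin n × Fin ℓ) → ℕ) (Ks : List (Clique n Δ)) →
    sum (map w (productEdges ℓ (edgesH Ks))) ≡ sum (map (cliqueWeight ℓ w) Ks)
  sum-map-productEdges ℓ w Ks = begin
    sum (map w (productEdges ℓ (edgesH Ks)))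
      ≡⟨ sum-map-concatMap w lift (edgesH Ks) ⟩
    sum (map (λ e → sum (map w (lift e))) (edgesH Ks))
      ≡⟨ sum-map-concatMap (λ e → sum (map w (lift e))) cliqueEdges Ks ⟩
    sum (map (λ K → sum (map (λ e → sum (map w (lift e))) (cliqueEdges K))) Ks)
      ≡⟨ cong sum (map-cong perClique Ks) ⟩
    sum (map (cliqueWeight ℓ w) Ks) ∎
    where
    open ≡-Reasoning
    lift : Fin n × Fin n → List ((Fin n × Fin ℓ) × (Fin n × Fin ℓ))
    lift (u , v) = concatMap (λ i → map (λ j → ((u , i) , (v , j))) (allFin ℓ)) (allFin ℓ)
    perClique : ∀ K → sum (map (λ e → sum (map w (lift e))) (cliqueEdges K)) ≡ cliqueWeight ℓ w K
    perClique K = trans (sum-map-cliqueEdges K (λ e → sum (map w (lift e))))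
      (∑-cong (λ p → ∑-cong (λ q → cong ([ p < q ] *_)
        (sum-map-grid ℓ ℓ w (λ i j → ((proj₁ K p , i) , (proj₁ K q , j)))))))

  productCut-bound : ∀ {Δ} ℓ (Ks : List (Clique n Δ)) (S : Fin n × Fin ℓ → Bool) →
    2 * (Δ ∸ 1) * cutSize S (productEdges ℓ (edgesH Ks)) ≤ Δ * length (productEdges ℓ (edgesH Ks))
  productCut-bound {Δ} ℓ Ks S = subst₂ (λ x y → 2 * (Δ ∸ 1) * x ≤ Δ * y)
    (sym (trans (length-filter≡sum _ E) (sum-map-productEdges ℓ cutWeight Ks)))
    (sym (trans (length≡sum-ones E) (sum-map-productEdges ℓ (λ _ → 1) Ks)))
    (sum-map-mono-* (2 * (Δ ∸ 1)) Δ perClique Ks)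
    where
    E = productEdges ℓ (edgesH Ks)
    -- Definitionally the indicator of the filter predicate in cutSize.
    cutWeight : (Fin n × Fin ℓ) × (Fin n × Fin ℓ) → ℕ
    cutWeight (x , y) = disagree (S x) (S y)
    edgeCount : ∀ K → pairSum {Δ} (λ _ _ → ℓ * ℓ) ≡ cliqueWeight ℓ (λ _ → 1) K
    edgeCount K = ∑-cong {Δ} (λ p → ∑-cong {Δ} (λ q → cong ([ p < q ] *_)
      (sym (trans (∑²-const {ℓ} {ℓ} 1) (cong (ℓ *_) (*-identityʳ ℓ))))))
    perClique : ∀ K → 2 * (Δ ∸ 1) * cliqueWeight ℓ cutWeight K ≤ Δ * cliqueWeight ℓ (λ _ → 1) K
    perClique K = subst (λ y → 2 * (Δ ∸ 1) * cliqueWeight ℓ cutWeight K ≤ Δ * y) (edgeCount K)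
      (cliqueCut-bound (λ p i → S (proj₁ K p , i)))

weaken-bound : ∀ {Δ} c L → 2 ≤ Δ → 2 * (Δ ∸ 1) * c ≤ Δ * L → 2 * Δ * c ≤ (Δ + 2) * L
weaken-bound {suc zero}    c L (s≤s ()) _
weaken-bound {suc (suc k)} c L _ bound = *-cancelˡ-≤ (suc k) (begin
  suc k * (2 * (2 + k) * c)       ≡⟨ commute k c ⟩
  (2 + k) * (2 * suc k * c)       ≤⟨ *-monoʳ-≤ (2 + k) bound ⟩
  (2 + k) * ((2 + k) * L)         ≤⟨ m≤m+n _ (k * L) ⟩
  (2 + k) * ((2 + k) * L) + k * L ≡⟨ expand k L ⟩
  suc k * ((2 + k + 2) * L)       ∎)
  where
  open ≤-Reasoning
  commute : ∀ k c → suc k * (2 * (2 + k) * c) ≡ (2 + k) * (2 * suc k * c)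
  commute = solve-∀
  expand : ∀ k L → (2 + k) * ((2 + k) * L) + k * L ≡ suc k * ((2 + k + 2) * L)
  expand = solve-∀

claim5p11 : (n Δ : ℕ) → 2 ≤ Δ → (Ks : List (Clique n Δ)) → Ks ≢ [] →
    (ℓ : ℕ) → 1 ≤ ℓ → (S : Fin n × Fin ℓ → Bool) →
    (2 * (Δ ∸ 1) * cutSize S (productEdges ℓ (edgesH Ks))
       ≤ Δ * length (productEdges ℓ (edgesH Ks)))
    × (2 * Δ * cutSize S (productEdges ℓ (edgesH Ks))
       ≤ (Δ + 2) * length (productEdges ℓ (edgesH Ks)))
claim5p11 n Δ 2≤Δ Ks _ ℓ _ S = bound , weaken-bound _ _ 2≤Δ bound
  where
  bound : 2 * (Δ ∸ 1) * cutSize S (productEdges ℓ (edgesH Ks)) ≤ Δ * length (productEdges ℓ (edgesH Ks))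
  bound = productCut-bound ℓ Ks S
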